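{- Let $a,b$ be positive integers, $\alpha\in\mathbb{N}^a$, $\beta\in\mathbb{N}^b$, and $n\in\mathbb{N}$. Then $$|Q(\alpha,\beta,n,1)|=\sum_{\gamma\in L(\alpha,\beta,n)}f_\gamma,\qquad\text{where } f_\gamma=\bigl|\{(i,j)\in[a]\times[b]:\gamma_{ij}\neq0\}\bigr|.$$
   Context: $[0,a]=\{0,\dots,a\}$, $[a]=\{1,\dots,a\}$. A cubical matrix is a map $\Gamma:[0,a]\times[0,b]\times\mathbb{N}\to\mathbb{N}$, $(i,j,k)\mapsto\Gamma_{ij}^k$. $Q(\alpha,\beta,n,m)$ is the set of cubical matrices with: $\Gamma_{00}^k=0$ for all $k\ge0$, and $\Gamma_{ij}^k=0$ for all $k\ge1$ whenever $i=0$ or $j=0$; $\sum_{i,j,k}\Gamma_{ij}^k\le n$ and $\sum_{i,j,k}k\,\Gamma_{ij}^k=m$; $\sum_{j=0}^b\sum_k\Gamma_{ij}^k=\alpha_i$ for $i\in[a]$ and $\sum_{i=0}^a\sum_k\Gamma_{ij}^k=\beta_j$ for $j\in[b]$. $L(\alpha,\beta,n)$ is the set of matrices $\gamma:[0,a]\times[0,b]\to\mathbb{N}$ with $\gamma_{00}=0$, $\sum_{i,j}\gamma_{ij}\le n$, $\sum_{j=0}^b\gamma_{ij}=\alpha_i$ for $i\in[a]$, and $\sum_{i=0}^a\gamma_{ij}=\beta_j$ for $j\in[b]$. -}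

module Defs where

open import Data.Nat using (ℕ; zero; suc; _+_; _*_; _≤_)
open import Data.Fin using (Fin; zero; suc)
open import Data.Product using (Σ; _×_; _,_)
open import Relation.Binary.PropositionalEquality using (_≡_)

∑ : ∀ {n} → (Fin n → ℕ) → ℕ
∑ {zero}  f = 0
∑ {suc n} f = f zero + ∑ (λ i → f (suc i))

psum : (ℕ → ℕ) → ℕ → ℕ
psum g zero    = 0
psum g (suc K) = psum g K + g K

SeriesLe : (ℕ → ℕ) → ℕ → Set
SeriesLe g s = ∀ K → psum g K ≤ s

-- The series of naturals converges with sum exactly s (sum = sup of partial sums).
SeriesEq : (ℕ → ℕ) → ℕ → Set
SeriesEq g s = SeriesLe g s × Σ ℕ (λ K → psum g K ≡ s)

-- Indices: [0,a] is Fin (suc a); index zero is 0 and suc i is i+1,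
-- so [a] corresponds to the successors, indexed by Fin a.

-- Cubical matrices  Γ : [0,a] × [0,b] × ℕ → ℕ,  Γ i j k = Γ_{ij}^k.
CubMat : ℕ → ℕ → Set
CubMat a b = Fin (suc a) → Fin (suc b) → ℕ → ℕ

Mat : ℕ → ℕ → Set
Mat a b = Fin (suc a) → Fin (suc b) → ℕ

_≈Cub_ : ∀ {a b} → CubMat a b → CubMat a b → Set
Γ ≈Cub Δ = ∀ i j k → Γ i j k ≡ Δ i j k

_≈Mat_ : ∀ {a b} → Mat a b → Mat a b → Set
γ ≈Mat δ = ∀ i j → γ i j ≡ δ i j

InQ : (a b : ℕ) → (Fin a → ℕ) → (Fin b → ℕ) → ℕ → ℕ → CubMat a b → Set
InQ a b α β n m Γ =
    (∀ k → Γ zero zero k ≡ 0)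
  × (∀ (j : Fin (suc b)) k → Γ zero j (suc k) ≡ 0)
  × (∀ (i : Fin (suc a)) k → Γ i zero (suc k) ≡ 0)
  × SeriesLe (λ k → ∑ (λ i → ∑ (λ j → Γ i j k))) n
  × SeriesEq (λ k → k * ∑ (λ i → ∑ (λ j → Γ i j k))) m
  × (∀ (i : Fin a) → SeriesEq (λ k → ∑ (λ j → Γ (suc i) j k)) (α i))
  × (∀ (j : Fin b) → SeriesEq (λ k → ∑ (λ i → Γ i (suc j) k)) (β j))

InL : (a b : ℕ) → (Fin a → ℕ) → (Fin b → ℕ) → ℕ → Mat a b → Set
InL a b α β n γ =
    γ zero zero ≡ 0
  × ∑ (λ i → ∑ (λ j → γ i j)) ≤ n
  × (∀ (i : Fin a) → ∑ (λ j → γ (suc i) j) ≡ α i)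
  × (∀ (j : Fin b) → ∑ (λ i → γ i (suc j)) ≡ β j)

record HasCard {A : Set} (_≈_ : A → A → Set) (P : A → Set) (N : ℕ) : Set where
  field
    enum : Fin N → A
    enum-in : ∀ t → P (enum t)
    enum-inj : ∀ s t → enum s ≈ enum t → s ≡ t
    enum-surj : ∀ x → P x → Σ (Fin N) (λ t → enum t ≈ x)

nz : ℕ → ℕ
nz zero    = 0
nz (suc _) = 1

fγ : ∀ {a b} → Mat a b → ℕ
fγ γ = ∑ (λ i → ∑ (λ j → nz (γ (suc i) (suc j))))

-- An element Γ of Q(α,β,n,1) has ∑ₖ k |Γᵏ| = 1, so its layers k ≥ 2 vanish and its layer 1 is
-- a matrix unit E_ij, with (i, j) ∈ [a] × [b] because of the border conditions. Hence Γ is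
-- determined by (i, j) and its flattening γ = Γ⁰ + Γ¹, which lies in L(α,β,n) and has γ_ij ≥ 1;
-- conversely every such pair (γ, (i, j)) gives Γ⁰ = γ - E_ij, Γ¹ = E_ij in Q(α,β,n,1). Counting
-- these pairs gives ∑_γ f_γ. L(α,β,n) is finite because the entries of its members are at most n.
module Submission where

open import Defs
open import Data.Nat using (ℕ; _≤_)
open import Data.Fin using (Fin)
open import Data.Product using (Σ; _×_)

open import Level using (0ℓ)
open import Data.Nat using (zero; suc; pred; _+_; _*_; _∸_; _^_; z≤n; s≤s)
open import Data.Nat.Properties
  using (≤-refl; ≤-trans; ≤-antisym; ≤-reflexive; m≤m+n; m≤n+m; m≤m*n; n≤0⇒n≡0; n≤1⇒n≡0∨n≡1;
         +-suc; +-comm; +-identityʳ; *-identityˡ; *-identityʳ; *-zeroʳ; *-distribˡ-+; *-mono-≤;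
         m*n≡1⇒m≡1; m*n≡1⇒n≡1; m∸n+n≡m; m+n∸n≡m; ≡-decSetoid; +-commutativeSemigroup)
  renaming (_≟_ to _≟ℕ_; _≤?_ to _≤?ℕ_)
open import Algebra.Properties.CommutativeSemigroup +-commutativeSemigroup
  using () renaming (interchange to +-interchange)
open import Data.Fin using (zero; suc; toℕ; fromℕ<; finToFun; funToFin)
open import Data.Fin.Properties using (_≟_; all?; toℕ-fromℕ<; finToFun-funToFin; +↔⊎)
open import Data.Product using (_,_; proj₁; proj₂)
open import Data.Sum using (_⊎_; inj₁; inj₂)
open import Data.Empty using (⊥-elim)
open import Data.List using (length; lookup; filter; deduplicate; tabulate)
import Data.List.Relation.Unary.All as All
import Data.List.Relation.Unary.Any as Any
open import Data.List.Relation.Unary.Any.Properties using (lookup-index)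
open import Data.List.Membership.Propositional.Properties using () renaming (∈-lookup to ∈ₚ-lookup)
open import Data.List.Membership.Setoid.Properties
  using (∈-filter⁻; ∈-filter⁺; ∈-lookup; ∈-deduplicate⁺; ∈-resp-≈; ∈-tabulate⁺)
import Data.List.Relation.Unary.Unique.Setoid.Properties as Unique
open import Data.List.Relation.Unary.Unique.DecSetoid.Properties using (deduplicate-!)
import Data.Vec.Functional.Relation.Binary.Pointwise.Properties as Pointwise
open import Function using (_∘_; _↔_; mk↔ₛ′; Inverse)
open import Function.Properties.Inverse using (↔-refl; ↔-sym; ↔-trans)
open import Data.Sum.Function.Propositional using (_⊎-↔_)
open import Data.Product.Function.Dependent.Propositional using (Σ-↔)
open import Relation.Nullary using (yes; no)
open import Relation.Nullary.Decidable using (_×-dec_)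
open import Relation.Unary using (Decidable)
open import Relation.Binary using (DecSetoid; _Respects_)
open import Relation.Binary.Properties.Setoid using (respʳ-flip)
open import Relation.Binary.PropositionalEquality
  using (_≡_; _≢_; refl; sym; trans; cong; cong₂; subst; module ≡-Reasoning)

∑-cong : ∀ {p} {f g : Fin p → ℕ} → (∀ i → f i ≡ g i) → ∑ f ≡ ∑ g
∑-cong {zero}  f≗g = refl
∑-cong {suc p} f≗g = cong₂ _+_ (f≗g zero) (∑-cong (f≗g ∘ suc))

∑-zero : ∀ {p} {f : Fin p → ℕ} → (∀ i → f i ≡ 0) → ∑ f ≡ 0
∑-zero {zero}  f≗0 = refl
∑-zero {suc p} f≗0 = cong₂ _+_ (f≗0 zero) (∑-zero (f≗0 ∘ suc))

∑-distrib-+ : ∀ {p} (f g : Fin p → ℕ) → ∑ (λ i → f i + g i) ≡ ∑ f + ∑ g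
∑-distrib-+ {zero}  f g = refl
∑-distrib-+ {suc p} f g =
  trans (cong (f zero + g zero +_) (∑-distrib-+ (f ∘ suc) (g ∘ suc)))
        (+-interchange (f zero) (g zero) _ _)

∑-*ˡ : ∀ {p} c (f : Fin p → ℕ) → ∑ (λ i → c * f i) ≡ c * ∑ f
∑-*ˡ {zero}  c f = sym (*-zeroʳ c)
∑-*ˡ {suc p} c f = trans (cong (c * f zero +_) (∑-*ˡ c (f ∘ suc))) (sym (*-distribˡ-+ c _ _))

term≤∑ : ∀ {p} (f : Fin p → ℕ) i → f i ≤ ∑ f
term≤∑ f zero    = m≤m+n _ _
term≤∑ f (suc i) = ≤-trans (term≤∑ (f ∘ suc) i) (m≤n+m _ (f zero))

∑≡0⇒≡0 : ∀ {p} (f : Fin p → ℕ) → ∑ f ≡ 0 → ∀ i → f i ≡ 0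
∑≡0⇒≡0 f ∑f≡0 i = n≤0⇒n≡0 (≤-trans (term≤∑ f i) (≤-reflexive ∑f≡0))

∑∑ : ∀ {p q} → (Fin p → Fin q → ℕ) → ℕ
∑∑ M = ∑ (λ x → ∑ (M x))

∑∑-distrib-+ : ∀ {p q} (M M' : Fin p → Fin q → ℕ) → ∑∑ (λ x y → M x y + M' x y) ≡ ∑∑ M + ∑∑ M'
∑∑-distrib-+ M M' =
  trans (∑-cong (λ x → ∑-distrib-+ (M x) (M' x))) (∑-distrib-+ (λ x → ∑ (M x)) (λ x → ∑ (M' x)))

δ : ∀ {p} → Fin p → Fin p → ℕ
δ zero    zero    = 1
δ zero    (suc x) = 0
δ (suc i) zero    = 0
δ (suc i) (suc x) = δ i x

δ-refl : ∀ {p} (i : Fin p) → δ i i ≡ 1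
δ-refl zero    = refl
δ-refl (suc i) = δ-refl i

δ-≢ : ∀ {p} {i x : Fin p} → i ≢ x → δ i x ≡ 0
δ-≢ {i = zero}  {zero}  i≢x = ⊥-elim (i≢x refl)
δ-≢ {i = zero}  {suc x} i≢x = refl
δ-≢ {i = suc i} {zero}  i≢x = refl
δ-≢ {i = suc i} {suc x} i≢x = δ-≢ (i≢x ∘ cong suc)

δ≡1⇒≡ : ∀ {p} {i x : Fin p} → δ i x ≡ 1 → i ≡ x
δ≡1⇒≡ {i = zero}  {zero}  _ = refl
δ≡1⇒≡ {i = suc i} {suc x} e = cong suc (δ≡1⇒≡ e)

∑-δ : ∀ {p} (i : Fin p) → ∑ (δ i) ≡ 1
∑-δ {suc p} zero = cong suc (∑-zero {p} (λ _ → refl))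
∑-δ (suc i)      = ∑-δ i

∑≡1⇒δ : ∀ {p} (f : Fin p → ℕ) → ∑ f ≡ 1 → Σ (Fin p) λ i → ∀ x → f x ≡ δ i x
∑≡1⇒δ {suc p} f ∑f≡1 with f zero in f₀
... | zero = let i , f≗δ = ∑≡1⇒δ (f ∘ suc) ∑f≡1 in
  suc i , λ { zero → f₀ ; (suc x) → f≗δ x }
... | suc zero = zero , λ { zero → f₀ ; (suc x) → ∑≡0⇒≡0 (f ∘ suc) (cong pred ∑f≡1) x }
... | suc (suc _) with () ← ∑f≡1

unit : ∀ {p q} → Fin p → Fin q → Fin p → Fin q → ℕ
unit i j x y = δ i x * δ j y

unit-refl : ∀ {p q} (i : Fin p) (j : Fin q) → unit i j i j ≡ 1
unit-refl i j = cong₂ _*_ (δ-refl i) (δ-refl j)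

unit≡1⇒≡ : ∀ {p q} {i x : Fin p} {j y : Fin q} → unit i j x y ≡ 1 → i ≡ x × j ≡ y
unit≡1⇒≡ {i = i} {x} {j} {y} e =
  δ≡1⇒≡ (m*n≡1⇒m≡1 (δ i x) (δ j y) e) , δ≡1⇒≡ (m*n≡1⇒n≡1 (δ i x) (δ j y) e)

unit≤1 : ∀ {p q} (i x : Fin p) (j y : Fin q) → unit i j x y ≤ 1
unit≤1 i x j y = *-mono-≤ (δ≤1 i x) (δ≤1 j y)
  where
    δ≤1 : ∀ {p} (i x : Fin p) → δ i x ≤ 1
    δ≤1 zero    zero    = ≤-refl
    δ≤1 zero    (suc x) = z≤n
    δ≤1 (suc i) zero    = z≤n
    δ≤1 (suc i) (suc x) = δ≤1 i x

unit-≤ : ∀ {p q} (M : Fin p → Fin q → ℕ) {i j} → 1 ≤ M i j → ∀ x y → unit i j x y ≤ M x y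
unit-≤ M {i} {j} pos x y with n≤1⇒n≡0∨n≡1 (unit≤1 i x j y)
... | inj₁ u≡0 = subst (_≤ M x y) (sym u≡0) z≤n
... | inj₂ u≡1 with refl , refl ← unit≡1⇒≡ {i = i} {x} {j} {y} u≡1 = subst (_≤ M x y) (sym u≡1) pos

∑∑-unit : ∀ {p q} (i : Fin p) (j : Fin q) → ∑∑ (unit i j) ≡ 1
∑∑-unit i j = begin
  ∑ (λ x → ∑ (λ y → δ i x * δ j y))  ≡⟨ ∑-cong (λ x → ∑-*ˡ (δ i x) (δ j)) ⟩
  ∑ (λ x → δ i x * ∑ (δ j))          ≡⟨ ∑-cong (λ x → cong (δ i x *_) (∑-δ j)) ⟩
  ∑ (λ x → δ i x * 1)                ≡⟨ ∑-cong (λ x → *-identityʳ (δ i x)) ⟩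
  ∑ (δ i)                            ≡⟨ ∑-δ i ⟩
  1                                  ∎
  where open ≡-Reasoning

∑∑≡1⇒unit : ∀ {p q} (M : Fin p → Fin q → ℕ) → ∑∑ M ≡ 1 →
            Σ (Fin p) λ i → Σ (Fin q) λ j → ∀ x y → M x y ≡ unit i j x y
∑∑≡1⇒unit M ∑∑M≡1 = i , j , entry
  where
    rows = ∑≡1⇒δ (λ x → ∑ (M x)) ∑∑M≡1
    i = proj₁ rows
    rowᵢ = ∑≡1⇒δ (M i) (trans (proj₂ rows i) (δ-refl i))
    j = proj₁ rowᵢ
    entry : ∀ x y → M x y ≡ unit i j x y
    entry x y with i ≟ x
    ... | yes refl = trans (proj₂ rowᵢ y) (sym (trans (cong (_* δ j y) (δ-refl i)) (*-identityˡ (δ j y))))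
    ... | no i≢x   = trans (∑≡0⇒≡0 (M x) (trans (proj₂ rows x) (δ-≢ i≢x)) y)
                           (sym (cong (_* δ j y) (δ-≢ i≢x)))

VanishesFrom : ℕ → (ℕ → ℕ) → Set
VanishesFrom K g = ∀ k → g (K + k) ≡ 0

psum-mono : ∀ g k d → psum g k ≤ psum g (k + d)
psum-mono g k zero    = ≤-reflexive (cong (psum g) (sym (+-identityʳ k)))
psum-mono g k (suc d) = subst (λ m → psum g k ≤ psum g m) (sym (+-suc k d))
                              (≤-trans (psum-mono g k d) (m≤m+n _ _))

psum-stable : ∀ {K g} → VanishesFrom K g → ∀ d → psum g (K + d) ≡ psum g K
psum-stable {K} {g} g₀ zero    = cong (psum g) (+-identityʳ K)
psum-stable {K} {g} g₀ (suc d) = begin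
  psum g (K + suc d)          ≡⟨ cong (psum g) (+-suc K d) ⟩
  psum g (K + d) + g (K + d)  ≡⟨ cong₂ _+_ (psum-stable {K} {g} g₀ d) (g₀ d) ⟩
  psum g K + 0                ≡⟨ +-identityʳ _ ⟩
  psum g K                    ∎
  where open ≡-Reasoning

psum≤psum-vanishing : ∀ {K g} → VanishesFrom K g → ∀ k → psum g k ≤ psum g K
psum≤psum-vanishing {K} {g} g₀ k =
  ≤-trans (psum-mono g k K)
          (≤-reflexive (trans (cong (psum g) (+-comm k K)) (psum-stable {K} {g} g₀ k)))

psum≤⇒seriesLe : ∀ {K g s} → VanishesFrom K g → psum g K ≤ s → SeriesLe g s
psum≤⇒seriesLe {K} {g} g₀ ≤s k = ≤-trans (psum≤psum-vanishing {K} {g} g₀ k) ≤s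

psum≡⇒seriesEq : ∀ {K g s} → VanishesFrom K g → psum g K ≡ s → SeriesEq g s
psum≡⇒seriesEq {K} {g} g₀ ≡s = psum≤⇒seriesLe {K} {g} g₀ (≤-reflexive ≡s) , K , ≡s

seriesEq⇒psum≡ : ∀ {K g s} → VanishesFrom K g → SeriesEq g s → psum g K ≡ s
seriesEq⇒psum≡ {K} {g} g₀ (≤s , k , ≡s) =
  ≤-antisym (≤s K) (subst (_≤ psum g K) ≡s (psum≤psum-vanishing {K} {g} g₀ k))

Σ-Fin-suc↔⊎ : ∀ {p} (P : Fin (suc p) → Set) → Σ (Fin (suc p)) P ↔ (P zero ⊎ Σ (Fin p) (P ∘ suc))
Σ-Fin-suc↔⊎ P = mk↔ₛ′ to from to∘from from∘to
  where
    to : Σ _ P → P zero ⊎ Σ _ (P ∘ suc)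
    to (zero  , u) = inj₁ u
    to (suc i , u) = inj₂ (i , u)
    from : P zero ⊎ Σ _ (P ∘ suc) → Σ _ P
    from (inj₁ u)       = zero , u
    from (inj₂ (i , u)) = suc i , u
    to∘from : ∀ v → to (from v) ≡ v
    to∘from (inj₁ u)       = refl
    to∘from (inj₂ (i , u)) = refl
    from∘to : ∀ v → from (to v) ≡ v
    from∘to (zero  , u) = refl
    from∘to (suc i , u) = refl

Fin-∑↔Σ : ∀ {p} (f : Fin p → ℕ) → Fin (∑ f) ↔ Σ (Fin p) (Fin ∘ f)
Fin-∑↔Σ {zero}  f = mk↔ₛ′ (λ ()) (λ ()) (λ ()) (λ ())
Fin-∑↔Σ {suc p} f =
  ↔-trans +↔⊎ (↔-trans (↔-refl ⊎-↔ Fin-∑↔Σ (f ∘ suc)) (↔-sym (Σ-Fin-suc↔⊎ (Fin ∘ f))))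

hasCard-↔ : ∀ {D A : Set} {_≈_ : A → A → Set} {P : A → Set} {N} → Fin N ↔ D → (f : D → A) →
            (∀ d → P (f d)) → (∀ d d' → f d ≈ f d' → d ≡ d') → (∀ x → P x → Σ D λ d → f d ≈ x) →
            HasCard _≈_ P N
hasCard-↔ {_≈_ = _≈_} N↔D f f∈P f-inj f-surj = record
  { enum      = f ∘ to
  ; enum-in   = f∈P ∘ to
  ; enum-inj  = λ s t eq →
      trans (sym (strictlyInverseʳ s)) (trans (cong from (f-inj _ _ eq)) (strictlyInverseʳ t))
  ; enum-surj = λ x Px → let d , fd≈x = f-surj x Px in
                from d , subst (λ d' → f d' ≈ x) (sym (strictlyInverseˡ d)) fd≈x
  }
  where open Inverse N↔D using (to; from; strictlyInverseˡ; strictlyInverseʳ)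

module _ (S : DecSetoid 0ℓ 0ℓ) where
  open DecSetoid S using (_≈_; setoid) renaming (Carrier to A; sym to ≈-sym; _≟_ to _≈?_)
  open import Data.List.Membership.Setoid setoid using (_∈_)
  open import Data.List.Relation.Unary.Unique.Setoid setoid using (Unique; _∷_)

  lookup-injective : ∀ {xs} → Unique xs → ∀ s t → lookup xs s ≈ lookup xs t → s ≡ t
  lookup-injective (_      ∷ _) zero    zero    _ = refl
  lookup-injective (x≉xs ∷ _) zero    (suc t) x≈ = ⊥-elim (All.lookup x≉xs (∈ₚ-lookup t) x≈)
  lookup-injective (x≉xs ∷ _) (suc s) zero    ≈x = ⊥-elim (All.lookup x≉xs (∈ₚ-lookup s) (≈-sym ≈x))
  lookup-injective (_      ∷ u) (suc s) (suc t) eq = cong suc (lookup-injective u s t eq)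

  hasCard-covered : ∀ {P : A → Set} {K} → Decidable P → P Respects _≈_ →
                    (c : Fin K → A) → (∀ x → P x → Σ (Fin K) λ k → c k ≈ x) → Σ ℕ (HasCard _≈_ P)
  hasCard-covered {P} P? P-resp c covers = length ys , record
    { enum      = lookup ys
    ; enum-in   = λ t → proj₂ (∈-filter⁻ setoid P? P-resp {xs = cs} (∈-lookup setoid ys t))
    ; enum-inj  = lookup-injective {ys} (Unique.filter⁺ setoid P? (deduplicate-! S (tabulate c)))
    ; enum-surj = λ x Px → let x∈ys = ys-complete Px in Any.index x∈ys , ≈-sym (lookup-index x∈ys)
    }
    where
      cs = deduplicate _≈?_ (tabulate c)
      ys = filter P? cs
      ys-complete : ∀ {x} → P x → x ∈ ys
      ys-complete {x} Px =
        ∈-filter⁺ setoid P? P-resp (∈-deduplicate⁺ setoid _≈?_ (respʳ-flip setoid) x∈c) Px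
        where
          x∈c : x ∈ tabulate c
          x∈c = let k , cₖ≈x = covers x Px in ∈-resp-≈ setoid cₖ≈x (∈-tabulate⁺ setoid k)

InL-resp : ∀ {a b α β n} {γ γ' : Mat a b} → γ ≈Mat γ' → InL a b α β n γ → InL a b α β n γ'
InL-resp {n = n} γ≈γ' (γ₀₀≡0 , total≤n , rows , cols) =
    trans (sym (γ≈γ' zero zero)) γ₀₀≡0
  , subst (_≤ n) (∑-cong λ x → ∑-cong (γ≈γ' x)) total≤n
  , (λ i → trans (sym (∑-cong (γ≈γ' (suc i)))) (rows i))
  , (λ j → trans (sym (∑-cong λ x → γ≈γ' x (suc j))) (cols j))

decodeMat : ∀ {p q} n → Fin ((suc n ^ q) ^ p) → Fin p → Fin q → ℕ
decodeMat n c x y = toℕ (finToFun (finToFun c x) y)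

decodeMat-surjective : ∀ {p q} n (M : Fin p → Fin q → ℕ) → (∀ x y → M x y ≤ n) →
                       Σ (Fin ((suc n ^ q) ^ p)) λ c → ∀ x y → decodeMat n c x y ≡ M x y
decodeMat-surjective {q = q} n M M≤n = funToFin row , λ x y → begin
  toℕ (finToFun (finToFun (funToFin row) x) y)  ≡⟨ cong (λ r → toℕ (finToFun r y)) (finToFun-funToFin row x) ⟩
  toℕ (finToFun (funToFin (entry x)) y)         ≡⟨ cong toℕ (finToFun-funToFin (entry x) y) ⟩
  toℕ (fromℕ< (s≤s (M≤n x y)))                  ≡⟨ toℕ-fromℕ< (s≤s (M≤n x y)) ⟩
  M x y                                         ∎
  where
    open ≡-Reasoning
    entry : ∀ x y → Fin (suc n)
    entry x y = fromℕ< (s≤s (M≤n x y))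
    row : ∀ x → Fin (suc n ^ q)
    row x = funToFin (entry x)

InL? : ∀ a b α β n → Decidable (InL a b α β n)
InL? a b α β n γ =
  (γ zero zero ≟ℕ 0) ×-dec (∑∑ γ ≤?ℕ n)
  ×-dec all? (λ i → ∑ (γ (suc i)) ≟ℕ α i) ×-dec all? (λ j → ∑ (λ x → γ x (suc j)) ≟ℕ β j)

InL⇒bounded : ∀ {a b α β n} {γ : Mat a b} → InL a b α β n γ → ∀ x y → γ x y ≤ n
InL⇒bounded {γ = γ} (_ , total≤n , _) x y =
  ≤-trans (term≤∑ (γ x) y) (≤-trans (term≤∑ (λ x → ∑ (γ x)) x) total≤n)

InL-hasCard : ∀ a b α β n → Σ ℕ (HasCard _≈Mat_ (InL a b α β n))
InL-hasCard a b α β n =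
  hasCard-covered (Pointwise.decSetoid (Pointwise.decSetoid ≡-decSetoid (suc b)) (suc a))
    (InL? a b α β n) InL-resp (decodeMat n) (λ γ γ∈L → decodeMat-surjective n γ (InL⇒bounded γ∈L))

layer : ∀ {a b} → CubMat a b → ℕ → Mat a b
layer Γ k x y = Γ x y k

flatten : ∀ {a b} → CubMat a b → Mat a b
flatten Γ x y = Γ x y 0 + Γ x y 1

TwoLayered : ∀ {a b} → CubMat a b → Set
TwoLayered Γ = ∀ x y k → Γ x y (2 + k) ≡ 0

ZeroBorder : ∀ {a b} → CubMat a b → Set
ZeroBorder Γ = (∀ k → Γ zero zero k ≡ 0)
         × (∀ y k → Γ zero y (suc k) ≡ 0)
         × (∀ x k → Γ x zero (suc k) ≡ 0)

module _ {a b} {Γ : CubMat a b} (two : TwoLayered Γ) where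

  private
    total-vanishes : VanishesFrom 2 (λ k → ∑∑ (layer Γ k))
    total-vanishes k = ∑-zero λ x → ∑-zero λ y → two x y k

    weighted-vanishes : VanishesFrom 2 (λ k → k * ∑∑ (layer Γ k))
    weighted-vanishes k = trans (cong ((2 + k) *_) (total-vanishes k)) (*-zeroʳ (2 + k))

    row-vanishes : ∀ x → VanishesFrom 2 (λ k → ∑ (λ y → Γ x y k))
    row-vanishes x k = ∑-zero λ y → two x y k

    col-vanishes : ∀ y → VanishesFrom 2 (λ k → ∑ (λ x → Γ x y k))
    col-vanishes y k = ∑-zero λ x → two x y k

    row-flatten : ∀ x → ∑ (flatten Γ x) ≡ ∑ (layer Γ 0 x) + ∑ (layer Γ 1 x)
    row-flatten x = ∑-distrib-+ (layer Γ 0 x) (layer Γ 1 x)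

    col-flatten : ∀ y → ∑ (λ x → flatten Γ x y) ≡ ∑ (λ x → Γ x y 0) + ∑ (λ x → Γ x y 1)
    col-flatten y = ∑-distrib-+ (λ x → Γ x y 0) (λ x → Γ x y 1)

  InQ⇒InL-flatten : ∀ {α β n m} → InQ a b α β n m Γ →
                    InL a b α β n (flatten Γ) × ∑∑ (layer Γ 1) ≡ m
  InQ⇒InL-flatten {n = n} (Γ₀₀≡0 , _ , _ , total≤n , weight , rows , cols) =
      ( cong₂ _+_ (Γ₀₀≡0 0) (Γ₀₀≡0 1)
      , subst (_≤ n) (sym (∑∑-distrib-+ (layer Γ 0) (layer Γ 1))) (total≤n 2)
      , (λ i → trans (row-flatten (suc i)) (seriesEq⇒psum≡ (row-vanishes (suc i)) (rows i)))
      , (λ j → trans (col-flatten (suc j)) (seriesEq⇒psum≡ (col-vanishes (suc j)) (cols j))) )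
    , trans (sym (+-identityʳ _)) (seriesEq⇒psum≡ weighted-vanishes weight)

  InL-flatten⇒InQ : ∀ {α β n m} → ZeroBorder Γ → InL a b α β n (flatten Γ) → ∑∑ (layer Γ 1) ≡ m →
                    InQ a b α β n m Γ
  InL-flatten⇒InQ {n = n} (Γ₀₀≡0 , Γ₀ⱼ≡0 , Γᵢ₀≡0) (_ , total≤n , rows , cols) weight =
      Γ₀₀≡0 , Γ₀ⱼ≡0 , Γᵢ₀≡0
    , psum≤⇒seriesLe total-vanishes (subst (_≤ n) (∑∑-distrib-+ (layer Γ 0) (layer Γ 1)) total≤n)
    , psum≡⇒seriesEq weighted-vanishes (trans (+-identityʳ _) weight)
    , (λ i → psum≡⇒seriesEq (row-vanishes (suc i)) (trans (sym (row-flatten (suc i))) (rows i)))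
    , (λ j → psum≡⇒seriesEq (col-vanishes (suc j)) (trans (sym (col-flatten (suc j))) (cols j)))

promote : ∀ {a b} → Mat a b → Fin a → Fin b → CubMat a b
promote γ i j x y zero          = γ x y ∸ unit (suc i) (suc j) x y
promote γ i j x y (suc zero)    = unit (suc i) (suc j) x y
promote γ i j x y (suc (suc k)) = 0

promote-cong : ∀ {a b} {γ γ' : Mat a b} {i j} → γ ≈Mat γ' → promote γ i j ≈Cub promote γ' i j
promote-cong {i = i} {j} γ≈γ' x y zero          = cong (_∸ unit (suc i) (suc j) x y) (γ≈γ' x y)
promote-cong             γ≈γ' x y (suc zero)    = refl
promote-cong             γ≈γ' x y (suc (suc k)) = refl

flatten-promote : ∀ {a b} (γ : Mat a b) {i j} → 1 ≤ γ (suc i) (suc j) → flatten (promote γ i j) ≈Mat γ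
flatten-promote γ pos x y = m∸n+n≡m (unit-≤ γ pos x y)

promote-flatten : ∀ {a b} {Γ : CubMat a b} {i j} → TwoLayered Γ →
                  (∀ x y → Γ x y 1 ≡ unit (suc i) (suc j) x y) → promote (flatten Γ) i j ≈Cub Γ
promote-flatten {Γ = Γ} two Γ₁≗unit x y zero =
  trans (cong (Γ x y 0 + Γ x y 1 ∸_) (sym (Γ₁≗unit x y))) (m+n∸n≡m (Γ x y 0) (Γ x y 1))
promote-flatten two Γ₁≗unit x y (suc zero)    = sym (Γ₁≗unit x y)
promote-flatten two Γ₁≗unit x y (suc (suc k)) = sym (two x y k)

promote-injective : ∀ {a b} {γ γ' : Mat a b} {i i' j j'} →
                    1 ≤ γ (suc i) (suc j) → 1 ≤ γ' (suc i') (suc j') →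
                    promote γ i j ≈Cub promote γ' i' j' → γ ≈Mat γ' × i ≡ i' × j ≡ j'
promote-injective {γ = γ} {γ'} {i} {i'} {j} {j'} pos pos' eq = γ≈γ' , sym i'≡i , sym j'≡j
  where
    γ≈γ' : γ ≈Mat γ'
    γ≈γ' x y = begin
      γ x y                        ≡⟨ flatten-promote γ pos x y ⟨
      flatten (promote γ i j) x y    ≡⟨ cong₂ _+_ (eq x y 0) (eq x y 1) ⟩
      flatten (promote γ' i' j') x y ≡⟨ flatten-promote γ' pos' x y ⟩
      γ' x y                       ∎
      where open ≡-Reasoning
    i'≡i×j'≡j : i' ≡ i × j' ≡ j
    i'≡i×j'≡j = unit≡1⇒≡ (trans (sym (eq (suc i) (suc j) 1)) (unit-refl i j))
    i'≡i = proj₁ i'≡i×j'≡j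
    j'≡j = proj₂ i'≡i×j'≡j

InL⇒InQ₁-promote : ∀ {a b α β n} {γ : Mat a b} {i j} → InL a b α β n γ → 1 ≤ γ (suc i) (suc j) →
                   InQ a b α β n 1 (promote γ i j)
InL⇒InQ₁-promote {γ = γ} {i} {j} γ∈L@(γ₀₀≡0 , _) pos =
  InL-flatten⇒InQ {Γ = promote γ i j} (λ _ _ _ → refl) border
    (InL-resp (λ x y → sym (flatten-promote γ pos x y)) γ∈L) (∑∑-unit (suc i) (suc j))
  where
    border : ZeroBorder (promote γ i j)
    border = (λ { zero → γ₀₀≡0 ; (suc zero) → refl ; (suc (suc k)) → refl })
           , (λ { y zero → refl ; y (suc k) → refl })
           , (λ { x zero → *-zeroʳ (δ (suc i) x) ; x (suc k) → refl })

[2+k]*n≤1⇒n≡0 : ∀ k n → (2 + k) * n ≤ 1 → n ≡ 0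
[2+k]*n≤1⇒n≡0 k zero    _ = refl
[2+k]*n≤1⇒n≡0 k (suc n) ≤1 with ≤-trans (m≤m*n (2 + k) (suc n)) ≤1
... | s≤s ()

InQ₁⇒TwoLayered : ∀ {a b α β n} {Γ : CubMat a b} → InQ a b α β n 1 Γ → TwoLayered Γ
InQ₁⇒TwoLayered {Γ = Γ} (_ , _ , _ , _ , (weight≤1 , _) , _) x y k =
  ∑≡0⇒≡0 (layer Γ (2 + k) x) (∑≡0⇒≡0 (λ x → ∑ (layer Γ (2 + k) x)) total≡0 x) y
  where
    weighted : ℕ → ℕ
    weighted k = k * ∑∑ (layer Γ k)
    total≡0 : ∑∑ (layer Γ (2 + k)) ≡ 0
    total≡0 = [2+k]*n≤1⇒n≡0 k _
      (≤-trans (m≤n+m (weighted (2 + k)) (psum weighted (2 + k))) (weight≤1 (3 + k)))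

InQ₁-classification : ∀ {a b α β n} {Γ : CubMat a b} → InQ a b α β n 1 Γ →
                      Σ (Fin a) λ i → Σ (Fin b) λ j →
                      InL a b α β n (flatten Γ) × 1 ≤ flatten Γ (suc i) (suc j)
                      × promote (flatten Γ) i j ≈Cub Γ
InQ₁-classification {a} {b} {Γ = Γ} Γ∈Q@(_ , Γ₀ⱼ≡0 , Γᵢ₀≡0 , _)
  with two ← InQ₁⇒TwoLayered {Γ = Γ} Γ∈Q
  with flatΓ∈L , ∑∑Γ₁≡1 ← InQ⇒InL-flatten {Γ = Γ} two Γ∈Q
  with ∑∑≡1⇒unit (layer Γ 1) ∑∑Γ₁≡1
... | zero , y , Γ₁≗unit
  with () ← trans (sym (Γ₀ⱼ≡0 y 0)) (trans (Γ₁≗unit zero y) (unit-refl {suc a} zero y))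
... | suc i , zero , Γ₁≗unit
  with () ← trans (sym (Γᵢ₀≡0 (suc i) 0)) (trans (Γ₁≗unit (suc i) zero) (unit-refl (suc i) (zero {b})))
... | suc i , suc j , Γ₁≗unit = i , j , flatΓ∈L , pos , promote-flatten {Γ = Γ} two Γ₁≗unit
  where
    pos : 1 ≤ flatten Γ (suc i) (suc j)
    pos = subst (λ v → 1 ≤ Γ (suc i) (suc j) 0 + v)
                (sym (trans (Γ₁≗unit (suc i) (suc j)) (unit-refl i j))) (m≤n+m 1 _)

Fin-nz⇒1≤ : ∀ {x} → Fin (nz x) → 1 ≤ x
Fin-nz⇒1≤ {suc x} _ = s≤s z≤n

1≤⇒Fin-nz : ∀ {x} → 1 ≤ x → Fin (nz x)
1≤⇒Fin-nz (s≤s _) = zero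

Fin-nz-irrelevant : ∀ {x} (u v : Fin (nz x)) → u ≡ v
Fin-nz-irrelevant {suc x} zero zero = refl

module _ {a b α β n N} (L-enum : HasCard _≈Mat_ (InL a b α β n) N) where
  open HasCard L-enum

  -- Fin (nz γᵢⱼ) has one element if γᵢⱼ ≠ 0 and none otherwise, so Marked is the set of pairs
  -- (γ ∈ L, nonzero entry (i, j) ∈ [a] × [b] of γ), and its size is ∑ f_γ.
  Marked : Set
  Marked = Σ (Fin N) λ t → Σ (Fin a) λ i → Σ (Fin b) λ j → Fin (nz (enum t (suc i) (suc j)))

  Fin-∑fγ↔Marked : Fin (∑ λ t → fγ (enum t)) ↔ Marked
  Fin-∑fγ↔Marked = ↔-trans (Fin-∑↔Σ _) (Σ-↔ ↔-refl (↔-trans (Fin-∑↔Σ _) (Σ-↔ ↔-refl (Fin-∑↔Σ _))))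

  promoteMarked : Marked → CubMat a b
  promoteMarked (t , i , j , _) = promote (enum t) i j

  promoteMarked-injective : ∀ d d' → promoteMarked d ≈Cub promoteMarked d' → d ≡ d'
  promoteMarked-injective (t , i , j , u) (t' , i' , j' , u') eq
    with enumₜ≈enumₜ' , refl , refl ← promote-injective (Fin-nz⇒1≤ u) (Fin-nz⇒1≤ u') eq
    with refl ← enum-inj t t' enumₜ≈enumₜ'
    = cong (λ v → t , i , j , v) (Fin-nz-irrelevant u u')

  promoteMarked-surjective : ∀ Γ → InQ a b α β n 1 Γ → Σ Marked λ d → promoteMarked d ≈Cub Γ
  promoteMarked-surjective Γ Γ∈Q
    with i , j , flatΓ∈L , pos , promote≈Γ ← InQ₁-classification {Γ = Γ} Γ∈Q
    with t , enumₜ≈flatΓ ← enum-surj (flatten Γ) flatΓ∈L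
    = (t , i , j , 1≤⇒Fin-nz (subst (1 ≤_) (sym (enumₜ≈flatΓ (suc i) (suc j))) pos))
    , λ x y k → trans (promote-cong enumₜ≈flatΓ x y k) (promote≈Γ x y k)

  InQ₁-hasCard : HasCard _≈Cub_ (InQ a b α β n 1) (∑ λ t → fγ (enum t))
  InQ₁-hasCard = hasCard-↔ Fin-∑fγ↔Marked promoteMarked
    (λ (t , i , j , u) → InL⇒InQ₁-promote (enum-in t) (Fin-nz⇒1≤ u))
    promoteMarked-injective promoteMarked-surjective

proposition3p5 : (a b : ℕ) → 1 ≤ a → 1 ≤ b → (α : Fin a → ℕ) → (β : Fin b → ℕ) → (n : ℕ) →
    Σ ℕ (λ N → HasCard _≈Mat_ (InL a b α β n) N)
    × (∀ N → (E : HasCard _≈Mat_ (InL a b α β n) N) →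
    HasCard _≈Cub_ (InQ a b α β n 1) (∑ (λ t → fγ (HasCard.enum E t))))
proposition3p5 a b _ _ α β n = InL-hasCard a b α β n , λ N E → InQ₁-hasCard E
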